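{- Let $n \geq 1$, $\Pi \subseteq S_n$ and $m \geq 4n$. Then the directed diameter of $G_m(\Pi)$ equals the directed diameter of $G_{4n}(\Pi)$.
   Context: Word graphs: for $\Pi \subseteq S_n$, $m > n$ and a set $B$ with $|B| = m$, the word graph $G_m = G_m(\Pi)$ is the directed graph whose vertices are the words $x_1 \dots x_n$ over $B$ with pairwise distinct letters, with arcs $x_1 x_2 \dots x_n \to x_2 \dots x_n y$ for every $y \in B\setminus\{x_1,\dots,x_n\}$ and $x_1 \dots x_n \to x_{\pi(1)} \dots x_{\pi(n)}$ for every $\pi \in \Pi$. -}

module Defs where

open import Data.Nat using (ℕ; zero; suc; _≤_; _<_)
open import Data.Fin using (Fin)
open import Data.Fin.Permutation using (Permutation′; _⟨$⟩ʳ_)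
open import Data.Vec using (Vec; []; _∷_; _∷ʳ_; lookup; tabulate)
open import Data.Product using (Σ; ∃; ∃-syntax; _×_)
open import Data.Sum using (_⊎_)
open import Relation.Binary.PropositionalEquality using (_≡_; _≢_)
open import Relation.Nullary using (¬_)
open import Relation.Unary using (Pred)

Word : ℕ → ℕ → Set
Word n m = Vec (Fin m) n

Distinct : ∀ {n m} → Word n m → Set
Distinct {n} x = ∀ (i j : Fin n) → lookup x i ≡ lookup x j → i ≡ j

NotIn : ∀ {n m} → Fin m → Word n m → Set
NotIn {n} y x = ∀ (i : Fin n) → lookup x i ≢ y

shift : ∀ {n m} → Word n m → Fin m → Word n m
shift []       y = []
shift (x ∷ xs) y = xs ∷ʳ y

permute : ∀ {n m} → Permutation′ n → Word n m → Word n m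
permute π x = tabulate (λ i → lookup x (π ⟨$⟩ʳ i))

Arc : ∀ {n} (Π : Pred (Permutation′ n) _) (m : ℕ) → Word n m → Word n m → Set
Arc {n} Π m x z =
  (∃[ y ] (NotIn y x × z ≡ shift x y))
  ⊎ (∃[ π ] (Π π × z ≡ permute π x))

Walk : ∀ {n} (Π : Pred (Permutation′ n) _) (m : ℕ) → ℕ → Word n m → Word n m → Set
Walk Π m zero    x z = x ≡ z
Walk Π m (suc k) x z = ∃[ w ] (Arc Π m x w × Walk Π m k w z)

HasDiameter : ∀ {n} (Π : Pred (Permutation′ n) _) (m : ℕ) → ℕ → Set
HasDiameter {n} Π m d =
  (∀ (x z : Word n m) → Distinct x → Distinct z →
     ∃[ k ] (k ≤ d × Walk Π m k x z))
  × (∃[ x ] ∃[ z ] (Distinct x × Distinct z ×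
     (∀ k → k < d → ¬ Walk Π m k x z)))

module Submission where

open import Defs
open import Data.Nat using (ℕ; _≤_; _*_)
open import Data.Fin.Permutation using (Permutation′)
open import Relation.Unary using (Pred)
open import Level using (0ℓ)
open import Function.Bundles using (_⇔_)

open import Data.Nat using (zero; suc; _+_; _<_)
import Data.Nat.Properties as ℕP
open import Data.Fin as Fin using (Fin; _↑ˡ_; _↑ʳ_)
import Data.Fin.Properties as FinP
open import Data.Fin.Permutation using (_⟨$⟩ʳ_)
open import Data.Vec using (Vec; []; _∷_; _∷ʳ_; lookup; tabulate; _++_)
open import Data.Vec.Properties
  using (lookup-++ˡ; lookup-++ʳ; lookup∘tabulate; tabulate∘lookup; tabulate-cong)
open import Data.Product using (∃-syntax; _×_; _,_; proj₁; proj₂)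
open import Data.Sum using (_⊎_; inj₁; inj₂)
open import Data.Empty using (⊥-elim)
open import Relation.Nullary using (¬_; yes; no)
open import Relation.Binary.PropositionalEquality
open import Function.Bundles using (mk⇔)

-- A walk in the word graph only ever asks which letters are
-- equal, so it can be transported to any other alphabet as long as a
-- suitable letter can always be found there.  We call two pairs of words
-- (w, z) and (w', z') *pattern-equivalent* when position i of w and
-- position j of z carry equal letters exactly when the same holds for w'
-- and z'.  If the target alphabet has more than 2n letters, every shift
-- step w → shift w y can be mirrored by a step w' → shift w' y' that keeps
-- the pattern relative to the fixed endpoint z' (take y' matching y inside
-- z', or a letter fresh for w' and z'), and permutation steps preserve the
-- pattern outright; at the end of the walk the pattern forces w' = z'.
-- Conversely any pair of distinct-letter words can be relabelled into an
-- alphabet of at least 2n letters with the same pattern.  Hence distances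
-- between pattern-equivalent pairs agree in G_a and G_b whenever a, b > 2n,
-- so the diameter is the same; the theorem is the case a = m, b = 4n.

SamePattern : ∀ {a b L p} → Vec (Fin a) L → Vec (Fin b) L →
              Vec (Fin a) p → Vec (Fin b) p → Set
SamePattern w w' z z' = ∀ i j → (lookup w i ≡ lookup z j → lookup w' i ≡ lookup z' j)
                              × (lookup w' i ≡ lookup z' j → lookup w i ≡ lookup z j)

SameLetterPattern : ∀ {a b p} → Fin a → Fin b → Vec (Fin a) p → Vec (Fin b) p → Set
SameLetterPattern y y' z z' = ∀ j → (y ≡ lookup z j → y' ≡ lookup z' j)
                                  × (y' ≡ lookup z' j → y ≡ lookup z j)

samePattern-sym : ∀ {a b L p} (w : Vec (Fin a) L) (w' : Vec (Fin b) L)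
  (z : Vec (Fin a) p) (z' : Vec (Fin b) p) →
  SamePattern w w' z z' → SamePattern w' w z' z
samePattern-sym w w' z z' same i j = proj₂ (same i j) , proj₁ (same i j)

samePattern-diagonal : ∀ {a b n} (z : Vec (Fin a) n) (w' z' : Vec (Fin b) n) →
  SamePattern z w' z z' → w' ≡ z'
samePattern-diagonal z w' z' same = begin
  w'                   ≡⟨ tabulate∘lookup w' ⟨
  tabulate (lookup w') ≡⟨ tabulate-cong (λ i → proj₁ (same i i) refl) ⟩
  tabulate (lookup z') ≡⟨ tabulate∘lookup z' ⟩
  z'                   ∎
  where open ≡-Reasoning

freshLetter : ∀ {L b} (v : Vec (Fin b) L) → L < b → ∃[ c ] (∀ i → lookup v i ≢ c)
freshLetter {L} {b} v L<b
  with FinP.¬∀⟶∃¬ b (λ c → ∃[ i ] (lookup v i ≡ c))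
         (λ c → FinP.any? (λ i → lookup v i Fin.≟ c)) notSurjective
  where
  notSurjective : ¬ (∀ c → ∃[ i ] (lookup v i ≡ c))
  notSurjective index with FinP.pigeonhole L<b (λ c → proj₁ (index c))
  ... | c , d , c<d , same = FinP.<⇒≢ c<d (begin
    c                          ≡⟨ proj₂ (index c) ⟨
    lookup v (proj₁ (index c)) ≡⟨ cong (lookup v) same ⟩
    lookup v (proj₁ (index d)) ≡⟨ proj₂ (index d) ⟩
    d                          ∎)
    where open ≡-Reasoning
... | c , missing = c , λ i eq → missing (i , eq)

-- If y occurs in z take the corresponding letter of z', else a fresh one.
matchLetter : ∀ {a b L p} (w : Vec (Fin a) L) (w' : Vec (Fin b) L)
  (z : Vec (Fin a) p) (z' : Vec (Fin b) p) →
  Distinct z → Distinct z' → SamePattern w w' z z' →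
  (y : Fin a) → NotIn y w → L + p < b →
  ∃[ y' ] (NotIn y' w' × SameLetterPattern y y' z z')
matchLetter {L = L} w w' z z' dz dz' same y y∉w L+p<b
  with FinP.any? (λ j → y Fin.≟ lookup z j)
... | yes (j₀ , y≡zj₀) = lookup z' j₀ , y'∉w' , matches
  where
  y'∉w' : NotIn (lookup z' j₀) w'
  y'∉w' i eq = y∉w i (trans (proj₂ (same i j₀) eq) (sym y≡zj₀))
  matches : SameLetterPattern y (lookup z' j₀) z z'
  matches j = (λ y≡zj → cong (lookup z') (dz j₀ j (trans (sym y≡zj₀) y≡zj)))
            , (λ eq → trans y≡zj₀ (cong (lookup z) (dz' j₀ j eq)))
... | no y∉z with freshLetter (w' ++ z') L+p<b
... | c , missing = c , c∉w' , matches
  where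
  c∉w' : NotIn c w'
  c∉w' i eq = missing (i ↑ˡ _) (trans (lookup-++ˡ w' z' i) eq)
  matches : SameLetterPattern y c z z'
  matches j = (λ eq → ⊥-elim (y∉z (j , eq)))
            , (λ eq → ⊥-elim (missing (L ↑ʳ j) (trans (lookup-++ʳ w' z' j) (sym eq))))

lookup-snoc-view : ∀ {a b n} (xs : Vec (Fin a) n) (xs' : Vec (Fin b) n) y y' (i : Fin (suc n)) →
  (∃[ j ] (lookup (xs ∷ʳ y) i ≡ lookup xs j × lookup (xs' ∷ʳ y') i ≡ lookup xs' j))
  ⊎ (lookup (xs ∷ʳ y) i ≡ y × lookup (xs' ∷ʳ y') i ≡ y')
lookup-snoc-view []       []         y y' Fin.zero    = inj₂ (refl , refl)
lookup-snoc-view (x ∷ xs) (x' ∷ xs') y y' Fin.zero    = inj₁ (Fin.zero , refl , refl)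
lookup-snoc-view (x ∷ xs) (x' ∷ xs') y y' (Fin.suc i) with lookup-snoc-view xs xs' y y' i
... | inj₁ (j , eq , eq') = inj₁ (Fin.suc j , eq , eq')
... | inj₂ new            = inj₂ new

lookup-shift-view : ∀ {a b n} (w : Vec (Fin a) n) (w' : Vec (Fin b) n) y y' (i : Fin n) →
  (∃[ j ] (lookup (shift w y) i ≡ lookup w j × lookup (shift w' y') i ≡ lookup w' j))
  ⊎ (lookup (shift w y) i ≡ y × lookup (shift w' y') i ≡ y')
lookup-shift-view (x ∷ xs) (x' ∷ xs') y y' i with lookup-snoc-view xs xs' y y' i
... | inj₁ (j , eq , eq') = inj₁ (Fin.suc j , eq , eq')
... | inj₂ new            = inj₂ new

samePattern-shift : ∀ {a b n p} (w : Vec (Fin a) n) (w' : Vec (Fin b) n)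
  (z : Vec (Fin a) p) (z' : Vec (Fin b) p) y y' →
  SamePattern w w' z z' → SameLetterPattern y y' z z' →
  SamePattern (shift w y) (shift w' y') z z'
samePattern-shift w w' z z' y y' same sameLetter i j with lookup-shift-view w w' y y' i
... | inj₁ (k , eq , eq') rewrite eq | eq' = same k j
... | inj₂ (eq , eq')     rewrite eq | eq' = sameLetter j

samePattern-permute : ∀ {a b n p} (π : Permutation′ n) (w : Vec (Fin a) n) (w' : Vec (Fin b) n)
  (z : Vec (Fin a) p) (z' : Vec (Fin b) p) →
  SamePattern w w' z z' → SamePattern (permute π w) (permute π w') z z'
samePattern-permute π w w' z z' same i j
  rewrite lookup∘tabulate (λ i → lookup w (π ⟨$⟩ʳ i)) i
        | lookup∘tabulate (λ i → lookup w' (π ⟨$⟩ʳ i)) i = same (π ⟨$⟩ʳ i) j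

simulateWalk : ∀ {n a b} (Π : Pred (Permutation′ n) 0ℓ) (k : ℕ)
  (w z : Word n a) (w' z' : Word n b) →
  n + n < b → Distinct z → Distinct z' → SamePattern w w' z z' →
  Walk Π a k w z → Walk Π b k w' z'
simulateWalk Π zero w .w w' z' _ _ _ same refl = samePattern-diagonal w w' z' same
simulateWalk Π (suc k) w z w' z' 2n<b dz dz' same (_ , inj₁ (y , y∉w , refl) , walk)
  with matchLetter w w' z z' dz dz' same y y∉w 2n<b
... | y' , y'∉w' , sameLetter =
  shift w' y' , inj₁ (y' , y'∉w' , refl)
  , simulateWalk Π k (shift w y) z (shift w' y') z' 2n<b dz dz'
      (samePattern-shift w w' z z' y y' same sameLetter) walk
simulateWalk Π (suc k) w z w' z' 2n<b dz dz' same (_ , inj₂ (π , π∈Π , refl) , walk) =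
  permute π w' , inj₂ (π , π∈Π , refl)
  , simulateWalk Π k (permute π w) z (permute π w') z' 2n<b dz dz'
      (samePattern-permute π w w' z z' same) walk

distinct-tail : ∀ {n a} {y : Fin a} {xs : Word n a} → Distinct (y ∷ xs) → Distinct xs
distinct-tail d i j eq = FinP.suc-injective (d (Fin.suc i) (Fin.suc j) eq)

distinct-head : ∀ {n a} {y : Fin a} {xs : Word n a} → Distinct (y ∷ xs) → NotIn y xs
distinct-head d i eq with d Fin.zero (Fin.suc i) (sym eq)
... | ()

distinct-cons : ∀ {n a} {y : Fin a} {xs : Word n a} → NotIn y xs → Distinct xs →
  Distinct (y ∷ xs)
distinct-cons y∉xs dxs Fin.zero    Fin.zero    eq = refl
distinct-cons y∉xs dxs Fin.zero    (Fin.suc j) eq = ⊥-elim (y∉xs j (sym eq))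
distinct-cons y∉xs dxs (Fin.suc i) Fin.zero    eq = ⊥-elim (y∉xs i eq)
distinct-cons y∉xs dxs (Fin.suc i) (Fin.suc j) eq = cong Fin.suc (dxs i j eq)

relabel : ∀ {a b p L} (z : Vec (Fin a) p) (z' : Vec (Fin b) p) → Distinct z → Distinct z' →
  (x : Vec (Fin a) L) → Distinct x → L + p ≤ b →
  ∃[ x' ] (Distinct x' × SamePattern x x' z z')
relabel z z' dz dz' [] _ _ = [] , (λ ()) , (λ ())
relabel z z' dz dz' (y ∷ xs) dx room
  with relabel z z' dz dz' xs (distinct-tail dx) (ℕP.<⇒≤ room)
... | xs' , dxs' , same
  with matchLetter xs xs' z z' dz dz' same y (distinct-head dx) room
... | y' , y'∉xs' , sameLetter = y' ∷ xs' , distinct-cons y'∉xs' dxs' , sameCons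
  where
  sameCons : SamePattern (y ∷ xs) (y' ∷ xs') z z'
  sameCons Fin.zero    j = sameLetter j
  sameCons (Fin.suc i) j = same i j

relabelPair : ∀ {n a b} (x z : Word n a) → Distinct x → Distinct z → n + n ≤ b →
  ∃[ x' ] ∃[ z' ] (Distinct x' × Distinct z' × SamePattern x' x z' z)
relabelPair {n} x z dx dz room
  with relabel [] [] (λ ()) (λ ()) z dz (subst (_≤ _) (sym (ℕP.+-identityʳ n))
                                           (ℕP.≤-trans (ℕP.m≤m+n n n) room))
... | z' , dz' , _ with relabel z z' dz dz' x dx room
... | x' , dx' , same = x' , z' , dx' , dz' , samePattern-sym x x' z z' same

diameter-transfer : ∀ {n} (Π : Pred (Permutation′ n) 0ℓ) (a b d : ℕ) →
  n + n < a → n + n < b → HasDiameter Π a d → HasDiameter Π b d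
diameter-transfer Π a b d 2n<a 2n<b (close , x , z , dx , dz , far) = close' , far'
  where
  close' : ∀ x' z' → Distinct x' → Distinct z' → ∃[ k ] (k ≤ d × Walk Π b k x' z')
  close' x' z' dx' dz' with relabelPair x' z' dx' dz' (ℕP.<⇒≤ 2n<a)
  ... | xa , za , dxa , dza , same with close xa za dxa dza
  ... | k , k≤d , walk = k , k≤d , simulateWalk Π k xa za x' z' 2n<b dza dz' same walk
  far' : ∃[ x' ] ∃[ z' ] (Distinct x' × Distinct z' × (∀ k → k < d → ¬ Walk Π b k x' z'))
  far' with relabelPair x z dx dz (ℕP.<⇒≤ 2n<b)
  ... | xb , zb , dxb , dzb , same = xb , zb , dxb , dzb ,
    λ k k<d walk → far k k<d (simulateWalk Π k xb zb x z 2n<a dzb dz same walk)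

mainTheorem9 : (n : ℕ) → 1 ≤ n → (Π : Pred (Permutation′ n) 0ℓ) →
    (m : ℕ) → 4 * n ≤ m →
    (d : ℕ) → HasDiameter Π m d ⇔ HasDiameter Π (4 * n) d
mainTheorem9 n 1≤n Π m 4n≤m d =
  mk⇔ (diameter-transfer Π m (4 * n) d 2n<m 2n<4n)
      (diameter-transfer Π (4 * n) m d 2n<4n 2n<m)
  where
  -- 4 * n unfolds to n + (n + (n + (n + 0))), and n ≥ 1
  2n<4n : n + n < 4 * n
  2n<4n = ℕP.+-monoʳ-< n (ℕP.m<m+n n (ℕP.≤-trans 1≤n (ℕP.m≤m+n n _)))
  2n<m : n + n < m
  2n<m = ℕP.<-≤-trans 2n<4n 4n≤m
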